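{- Let $R$ be a commutative ring, $n\ge 1$, and let $A=\{a_{ij}:1\le i,j\le 2n\}$ be an alphabet of symbols indexed by pairs. Define the symmetric $2n\times 2n$ matrix $Q$ with entries in $R\langle A\rangle$ by $Q_{kl}=a_{kl}+a_{lk}$ for $k\ne l$ and $Q_{kk}=0$. Then, in the shuffle algebra $R\langle A\rangle_{\,ш\,}$, $$\sum_{\sigma\in\mathfrak S_{2n}}a_{\sigma(1)\sigma(2)}a_{\sigma(3)\sigma(4)}\cdots a_{\sigma(2n-1)\sigma(2n)}={\rm Hf}_{\,ш\,}(Q),$$ where each term on the left is a word of length $n$ in the letters $a_{ij}$.
   Context: For an alphabet $A$, $R\langle A\rangle$ is the free $R$-module on the set of words over $A$, and the shuffle product $ш$ is the bilinear product defined recursively by $u\,ш\,1=1\,ш\,u=u$ and $au\,ш\,bv=a(u\,ш\,bv)+b(au\,ш\,v)$ for letters $a,b$ and words $u,v$; $R\langle A\rangle_{\,ш\,}$ is then a commutative associative $R$-algebra. For a symmetric matrix $M$ of order $2n$ over a commutative ring, the hafnian is ${\rm Hf}(M)=\sum M_{i_1j_1}M_{i_2j_2}\cdots M_{i_nj_n}$, the sum running over all decompositions of $\{1,\dots,2n\}$ into disjoint sets $\{i_1<\cdots<i_n\}$ and $\{j_1<\cdots<j_n\}$ with $i_k<j_k$ for each $k$ (i.e. over perfect matchings). ${\rm Hf}_{\,ш\,}$ is the hafnian computed in $R\langle A\rangle_{\,ш\,}$. -}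

module Defs where

open import Level using (Level)
open import Algebra.Bundles using (CommutativeRing)
open import Data.Nat using (ℕ; zero; suc)
open import Data.Fin using (Fin; _≟_)
open import Data.List using (List; []; _∷_; _++_; map; concatMap; foldr; allFin)
open import Data.Product using (_×_; _,_)
import Data.Product.Properties as ×P
import Data.List.Properties as LP
open import Relation.Nullary using (yes; no)
open import Relation.Binary.Definitions using (DecidableEquality)

insertions : ∀ {a} {X : Set a} → X → List X → List (List X)
insertions x [] = (x ∷ []) ∷ []
insertions x (y ∷ ys) = (x ∷ y ∷ ys) ∷ map (y ∷_) (insertions x ys)

-- all orderings (arrangements) of a list; for allFin m these are exactly the
-- lists (σ(1),…,σ(m)) for σ ∈ S_m, each occurring once
perms : ∀ {a} {X : Set a} → List X → List (List X)
perms [] = [] ∷ []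
perms (x ∷ xs) = concatMap (insertions x) (perms xs)

select : ∀ {a} {X : Set a} → List X → List (X × List X)
select [] = []
select (x ∷ xs) = (x , xs) ∷ map (λ { (y , ys) → (y , x ∷ ys) }) (select xs)

-- For an increasing list this enumerates
-- each perfect matching {i₁<j₁},…,{iₖ<jₖ} exactly once.
matchings : ∀ {a} {X : Set a} → ℕ → List X → List (List (X × X))
matchings zero [] = [] ∷ []
matchings zero (_ ∷ _) = []
matchings (suc k) [] = []
matchings (suc k) (i ∷ rest) =
  concatMap (λ { (j , rest') → map ((i , j) ∷_) (matchings k rest') }) (select rest)

module FreeAlg {c ℓ : Level} (R : CommutativeRing c ℓ) (m : ℕ) where
  open CommutativeRing R

  Letter : Set
  Letter = Fin m × Fin m

  Word : Set
  Word = List Letter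

  _≟W_ : DecidableEquality Word
  _≟W_ = LP.≡-dec (×P.≡-dec _≟_ _≟_)

  -- elements of R⟨A⟩ as formal finite linear combinations of words
  Poly : Set c
  Poly = List (Carrier × Word)

  coeff : Poly → Word → Carrier
  coeff [] w = 0#
  coeff ((r , u) ∷ p) w with u ≟W w
  ... | yes _ = r + coeff p w
  ... | no _ = coeff p w

  _≈P_ : Poly → Poly → Set ℓ
  p ≈P q = ∀ w → coeff p w ≈ coeff q w

  0P : Poly
  0P = []

  1P : Poly
  1P = (1# , []) ∷ []

  _+P_ : Poly → Poly → Poly
  _+P_ = _++_

  word : Word → Poly
  word w = (1# , w) ∷ []

  letter : Letter → Poly
  letter a = word (a ∷ [])

  sumP : List Poly → Poly
  sumP = foldr _+P_ 0P

  shuffleW : Word → Word → List Word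
  shuffleW [] v = v ∷ []
  shuffleW (a ∷ u) [] = (a ∷ u) ∷ []
  shuffleW (a ∷ u) (b ∷ v) =
    map (a ∷_) (shuffleW u (b ∷ v)) ++ map (b ∷_) (shuffleW (a ∷ u) v)

  _ш_ : Poly → Poly → Poly
  p ш q = concatMap (λ { (r , u) →
            concatMap (λ { (s , v) → map (λ w → (r * s , w)) (shuffleW u v) }) q }) p

  productш : List Poly → Poly
  productш = foldr _ш_ 1P

  Hfш : (k : ℕ) → (Fin m → Fin m → Poly) → Poly
  Hfш k M = sumP (map (λ μ → productш (map (λ { (i , j) → M i j }) μ))
                      (matchings k (allFin m)))

  Q : Fin m → Fin m → Poly
  Q k l with k ≟ l
  ... | yes _ = 0P
  ... | no _ = letter (k , l) +P letter (l , k)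

  pairWord : List (Fin m) → Word
  pairWord (x ∷ y ∷ r) = (x , y) ∷ pairWord r
  pairWord _ = []

  permSum : Poly
  permSum = sumP (map (λ σ → word (pairWord σ)) (perms (allFin m)))

-- The shuffle product of single letters is the sum of all their arrangements, so expanding
-- Hf_ш(Q) = Σ_μ ш_{{i,j} ∈ μ} (a_ij + a_ji) produces, with coefficient 1, one word for every
-- perfect matching μ, orientation of its pairs and ordering of the oriented pairs.  Cutting
-- σ ∈ S_2n into the ordered pairs (σ1,σ2),(σ3,σ4),… is a bijection onto exactly these data,
-- so both sides are the same multiset of words, each with coefficient 1.  The bijection is
-- built by induction on n: an ordered matching of x ∷ xs is an ordered matching of the
-- entries other than x and its partner j, with the pair {x, j} inserted in either
-- orientation at any position.

module Submission where

open import Defs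
open import Level using (Level)
open import Algebra.Bundles using (CommutativeRing)
open import Data.Nat using (ℕ; zero; suc; _+_; _≤_; _*_)
open import Data.Nat.Properties using (*-suc)
open import Data.List using (List; []; _∷_; _++_; map; concatMap; foldr; allFin; length)
import Data.List.Properties as List
open import Data.List.Effectful using (module MonadProperties)
open import Data.List.Relation.Binary.Permutation.Propositional
open import Data.List.Relation.Binary.Permutation.Propositional.Properties
  using (++⁺; ++⁺ˡ; shifts; shift; map⁺)
open import Data.List.Relation.Unary.All as All using (All; []; _∷_)
import Data.List.Relation.Unary.All.Properties as All
open import Data.List.Relation.Unary.AllPairs using (AllPairs; []; _∷_)
open import Data.Product using (_×_; _,_; proj₁; proj₂)
open import Function using (_∘_; flip; id)
open import Data.Bool using (if_then_else_)
open import Data.Empty using (⊥-elim)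
open import Data.Fin using (Fin; _≟_)
open import Data.List.Relation.Unary.Unique.Propositional.Properties using (allFin⁺)
open import Relation.Nullary using (does; yes; no)
open import Relation.Binary.PropositionalEquality as ≡
  using (_≡_; _≢_; refl; cong; cong₂; sym; module ≡-Reasoning)

private variable
  a : Level
  A B X : Set a

concatMap⁺ : (f : A → List B) {xs ys : List A} → xs ↭ ys → concatMap f xs ↭ concatMap f ys
concatMap⁺ f refl = ↭-refl
concatMap⁺ f (prep x p) = ++⁺ˡ (f x) (concatMap⁺ f p)
concatMap⁺ f (swap x y p) =
  ↭-trans (shifts (f x) (f y)) (++⁺ˡ (f y) (++⁺ˡ (f x) (concatMap⁺ f p)))
concatMap⁺ f (trans p q) = ↭-trans (concatMap⁺ f p) (concatMap⁺ f q)

concatMap-All-cong-↭ : {f g : A → List B} {xs : List A} → All (λ x → f x ↭ g x) xs →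
                       concatMap f xs ↭ concatMap g xs
concatMap-All-cong-↭ [] = ↭-refl
concatMap-All-cong-↭ (p ∷ ps) = ++⁺ p (concatMap-All-cong-↭ ps)

concatMap-cong-↭ : {f g : A → List B} → (∀ x → f x ↭ g x) →
                   ∀ xs → concatMap f xs ↭ concatMap g xs
concatMap-cong-↭ f↭g xs = concatMap-All-cong-↭ (All.universal f↭g xs)

concatMap-++-↭ : (f g : A → List B) (xs : List A) →
                 concatMap (λ x → f x ++ g x) xs ↭ concatMap f xs ++ concatMap g xs
concatMap-++-↭ f g [] = ↭-refl
concatMap-++-↭ f g (x ∷ xs) = begin
  (f x ++ g x) ++ concatMap (λ x → f x ++ g x) xs  ≡⟨ List.++-assoc (f x) (g x) _ ⟩
  f x ++ g x ++ concatMap (λ x → f x ++ g x) xs    ↭⟨ ++⁺ˡ (f x) (++⁺ˡ (g x) (concatMap-++-↭ f g xs)) ⟩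
  f x ++ g x ++ concatMap f xs ++ concatMap g xs   ↭⟨ ++⁺ˡ (f x) (shifts (g x) (concatMap f xs)) ⟩
  f x ++ concatMap f xs ++ g x ++ concatMap g xs   ≡⟨ List.++-assoc (f x) (concatMap f xs) _ ⟨
  (f x ++ concatMap f xs) ++ g x ++ concatMap g xs ∎
  where open PermutationReasoning

concatMap-concatMap : ∀ {A B C : Set a} (f : B → List C) (g : A → List B) (xs : List A) →
                      concatMap f (concatMap g xs) ≡ concatMap (concatMap f ∘ g) xs
concatMap-concatMap f g xs = sym (MonadProperties.associative xs g f)

concatMap-singleton : (f : A → B) (xs : List A) → concatMap (λ x → f x ∷ []) xs ≡ map f xs
concatMap-singleton f xs =
  ≡.trans (sym (List.concatMap-map (_∷ []) f xs)) (List.concatMap-pure (map f xs))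

concatSelect : (X → List X → List B) → List X → List B
concatSelect F xs = concatMap (λ yr → F (proj₁ yr) (proj₂ yr)) (select xs)

concatSelect-∷ : (F : X → List X → List B) (x : X) (xs : List X) →
                 concatSelect F (x ∷ xs) ≡ F x xs ++ concatSelect (λ y ys → F y (x ∷ ys)) xs
concatSelect-∷ F x xs =
  cong (F x xs ++_) (List.concatMap-map (λ yr → F (proj₁ yr) (proj₂ yr)) _ (select xs))

concatSelect-cong : {F G : X → List X → List B} → (∀ y ys → F y ys ≡ G y ys) →
                    ∀ xs → concatSelect F xs ≡ concatSelect G xs
concatSelect-cong F≡G xs = List.concatMap-cong (λ yr → F≡G (proj₁ yr) (proj₂ yr)) (select xs)

concatSelect-cong-↭ : {F G : X → List X → List B} → (∀ y ys → F y ys ↭ G y ys) →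
                      ∀ xs → concatSelect F xs ↭ concatSelect G xs
concatSelect-cong-↭ F↭G xs = concatMap-cong-↭ (λ yr → F↭G (proj₁ yr) (proj₂ yr)) (select xs)

concatSelect-++-↭ : (F G : X → List X → List B) (xs : List X) →
  concatSelect (λ y ys → F y ys ++ G y ys) xs ↭ concatSelect F xs ++ concatSelect G xs
concatSelect-++-↭ F G xs = concatMap-++-↭ _ _ (select xs)

concatMap-concatSelect : ∀ {X B C : Set a} (f : B → List C) (G : X → List X → List B) xs →
  concatMap f (concatSelect G xs) ≡ concatSelect (λ y ys → concatMap f (G y ys)) xs
concatMap-concatSelect f G xs = concatMap-concatMap f _ (select xs)

map-concatSelect : ∀ {X B C : Set a} (f : B → C) (G : X → List X → List B) xs →
  map f (concatSelect G xs) ≡ concatSelect (λ y ys → map f (G y ys)) xs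
map-concatSelect f G xs = List.map-concatMap f _ (select xs)

select-All : {P : X → Set a} {xs : List X} → All P xs →
             All (λ yr → P (proj₁ yr) × All P (proj₂ yr)) (select xs)
select-All [] = []
select-All (px ∷ pxs) =
  (px , pxs) ∷ All.map⁺ (All.map (λ (py , pys) → py , px ∷ pys) (select-All pxs))

select-AllPairs : {R : X → X → Set a} {xs : List X} → AllPairs R xs →
                  All (AllPairs R ∘ proj₂) (select xs)
select-AllPairs [] = []
select-AllPairs (rx ∷ rxs) = rxs ∷ All.map⁺
  (All.zipWith (λ ((_ , rys) , ap) → rys ∷ ap) (select-All rx , select-AllPairs rxs))

-- Ranges over the ordered pairs (a , b) of entries at distinct positions, s being the rest.
concatSelect₂ : (X → X → List X → List B) → List X → List B
concatSelect₂ F = concatSelect (λ a → concatSelect (F a))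

concatSelect₂-∷ : ∀ (F : X → X → List X → List B) y ys →
  concatSelect₂ F (y ∷ ys) ↭ concatSelect (F y) ys ++ concatSelect (λ a → F a y) ys
                             ++ concatSelect₂ (λ a b s → F a b (y ∷ s)) ys
concatSelect₂-∷ F y ys = begin
  concatSelect₂ F (y ∷ ys)
    ≡⟨ concatSelect-∷ (λ a → concatSelect (F a)) y ys ⟩
  concatSelect (F y) ys ++ concatSelect (λ a s → concatSelect (F a) (y ∷ s)) ys
    ≡⟨ cong (concatSelect (F y) ys ++_) (concatSelect-cong (λ a s → concatSelect-∷ (F a) y s) ys) ⟩
  concatSelect (F y) ys ++ concatSelect (λ a s → F a y s ++ concatSelect (λ b r → F a b (y ∷ r)) s) ys
    ↭⟨ ++⁺ˡ (concatSelect (F y) ys) (concatSelect-++-↭ (λ a → F a y) _ ys) ⟩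
  concatSelect (F y) ys ++ concatSelect (λ a → F a y) ys ++ concatSelect₂ (λ a b s → F a b (y ∷ s)) ys ∎
  where open PermutationReasoning

concatSelect₂-swap : ∀ (F : X → X → List X → List B) xs →
                     concatSelect₂ F xs ↭ concatSelect₂ (flip F) xs
concatSelect₂-swap F [] = ↭-refl
concatSelect₂-swap F (y ∷ ys) = begin
  concatSelect₂ F (y ∷ ys)
    ↭⟨ concatSelect₂-∷ F y ys ⟩
  concatSelect (F y) ys ++ concatSelect (λ a → F a y) ys ++ concatSelect₂ (λ a b s → F a b (y ∷ s)) ys
    ↭⟨ shifts (concatSelect (F y) ys) (concatSelect (λ a → F a y) ys) ⟩
  concatSelect (λ a → F a y) ys ++ concatSelect (F y) ys ++ concatSelect₂ (λ a b s → F a b (y ∷ s)) ys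
    ↭⟨ ++⁺ˡ (concatSelect (λ a → F a y) ys) (++⁺ˡ (concatSelect (F y) ys)
         (concatSelect₂-swap (λ a b s → F a b (y ∷ s)) ys)) ⟩
  concatSelect (λ a → F a y) ys ++ concatSelect (F y) ys ++ concatSelect₂ (λ a b s → F b a (y ∷ s)) ys
    ↭⟨ concatSelect₂-∷ (flip F) y ys ⟨
  concatSelect₂ (flip F) (y ∷ ys) ∎
  where open PermutationReasoning

concatSelect₂-cong-↭ : {F G : X → X → List X → List B} → (∀ a b s → F a b s ↭ G a b s) →
                       ∀ xs → concatSelect₂ F xs ↭ concatSelect₂ G xs
concatSelect₂-cong-↭ F↭G = concatSelect-cong-↭ (λ a → concatSelect-cong-↭ (F↭G a))

concatMap-concatSelect₂ : ∀ {X B C : Set a} (f : B → List C) (G : X → X → List X → List B) xs →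
  concatMap f (concatSelect₂ G xs) ≡ concatSelect₂ (λ a b s → concatMap f (G a b s)) xs
concatMap-concatSelect₂ f G xs = ≡.trans (concatMap-concatSelect f _ xs)
  (concatSelect-cong (λ a → concatMap-concatSelect f (G a)) xs)

concatSelect-concatSelect₂-comm : ∀ (G : X → X → X → List X → List B) xs →
  concatSelect (λ j → concatSelect₂ (G j)) xs
    ↭ concatSelect₂ (λ a b → concatSelect (λ j → G j a b)) xs
concatSelect-concatSelect₂-comm G xs = begin
  concatSelect₂ (λ j a → concatSelect (G j a)) xs
    ↭⟨ concatSelect₂-swap _ xs ⟩
  concatSelect (λ a → concatSelect₂ (λ j → G j a)) xs
    ↭⟨ concatSelect-cong-↭ (λ a → concatSelect₂-swap (λ j → G j a)) xs ⟩
  concatSelect₂ (λ a b → concatSelect (λ j → G j a b)) xs ∎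
  where open PermutationReasoning

laterInsertions : X → List X → List (List X)
laterInsertions x [] = []
laterInsertions x (y ∷ ys) = map (y ∷_) (insertions x ys)

insertions-head : (x : X) (u : List X) → insertions x u ≡ (x ∷ u) ∷ laterInsertions x u
insertions-head x [] = refl
insertions-head x (y ∷ ys) = refl

concatMap-insertions : (x : X) (U : List (List X)) →
  concatMap (insertions x) U ↭ map (x ∷_) U ++ concatMap (laterInsertions x) U
concatMap-insertions x U = begin
  concatMap (insertions x) U
    ≡⟨ List.concatMap-cong (insertions-head x) U ⟩
  concatMap (λ u → (x ∷ u) ∷ [] ++ laterInsertions x u) U
    ↭⟨ concatMap-++-↭ _ _ U ⟩
  concatMap (λ u → (x ∷ u) ∷ []) U ++ concatMap (laterInsertions x) U
    ≡⟨ cong (_++ concatMap (laterInsertions x) U) (concatMap-singleton (x ∷_) U) ⟩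
  map (x ∷_) U ++ concatMap (laterInsertions x) U ∎
  where open PermutationReasoning

concatMap-laterInsertions-∷ : (x y : X) (U : List (List X)) →
  concatMap (laterInsertions x) (map (y ∷_) U) ≡ map (y ∷_) (concatMap (insertions x) U)
concatMap-laterInsertions-∷ x y U = ≡.trans (List.concatMap-map (laterInsertions x) (y ∷_) U)
  (sym (List.map-concatMap (y ∷_) (insertions x) U))

-- Empty unless k is the length of xs.
arrangements : ℕ → List X → List (List X)
arrangements zero [] = [] ∷ []
arrangements zero (_ ∷ _) = []
arrangements (suc k) = concatSelect (λ y ys → map (y ∷_) (arrangements k ys))

insertions-arrangements : ∀ k (x : X) xs →
  concatMap (insertions x) (arrangements k xs) ↭ arrangements (suc k) (x ∷ xs)
insertions-arrangements zero x [] = ↭-refl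
insertions-arrangements zero x (y ∷ ys) =
  ↭-reflexive (sym (≡.trans (concatSelect-∷ (λ z zs → map (z ∷_) (arrangements 0 zs)) x (y ∷ ys))
                            (MonadProperties.right-zero (select (y ∷ ys)))))
insertions-arrangements (suc k) x xs = begin
  concatMap (insertions x) (arrangements (suc k) xs)
    ↭⟨ concatMap-insertions x (arrangements (suc k) xs) ⟩
  map (x ∷_) (arrangements (suc k) xs) ++ concatMap (laterInsertions x) (arrangements (suc k) xs)
    ≡⟨ cong (map (x ∷_) (arrangements (suc k) xs) ++_) (≡.trans
         (concatMap-concatSelect (laterInsertions x) _ xs)
         (concatSelect-cong (λ y ys → concatMap-laterInsertions-∷ x y (arrangements k ys)) xs)) ⟩
  map (x ∷_) (arrangements (suc k) xs) ++
    concatSelect (λ y ys → map (y ∷_) (concatMap (insertions x) (arrangements k ys))) xs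
    ↭⟨ ++⁺ˡ (map (x ∷_) (arrangements (suc k) xs))
         (concatSelect-cong-↭ (λ y ys → map⁺ (y ∷_) (insertions-arrangements k x ys)) xs) ⟩
  map (x ∷_) (arrangements (suc k) xs) ++
    concatSelect (λ y ys → map (y ∷_) (arrangements (suc k) (x ∷ ys))) xs
    ≡⟨ concatSelect-∷ (λ y ys → map (y ∷_) (arrangements (suc k) ys)) x xs ⟨
  arrangements (suc (suc k)) (x ∷ xs) ∎
  where open PermutationReasoning

perms-↭-arrangements : (xs : List X) → perms xs ↭ arrangements (length xs) xs
perms-↭-arrangements [] = ↭-refl
perms-↭-arrangements (x ∷ xs) = ↭-trans (concatMap⁺ (insertions x) (perms-↭-arrangements xs))
                                        (insertions-arrangements (length xs) x xs)

pairs : List X → List (X × X)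
pairs (x ∷ y ∷ xs) = (x , y) ∷ pairs xs
pairs _ = []

orderedMatchings : ℕ → List X → List (List (X × X))
orderedMatchings zero [] = [] ∷ []
orderedMatchings zero (_ ∷ _) = []
orderedMatchings (suc k) = concatSelect₂ (λ a b s → map ((a , b) ∷_) (orderedMatchings k s))

pairs-arrangements : ∀ k (xs : List X) → map pairs (arrangements (2 * k) xs) ≡ orderedMatchings k xs
pairs-arrangements zero [] = refl
pairs-arrangements zero (_ ∷ _) = refl
pairs-arrangements (suc k) xs = begin
  map pairs (arrangements (2 * suc k) xs)
    ≡⟨ cong (λ n → map pairs (arrangements n xs)) (*-suc 2 k) ⟩
  map pairs (arrangements (2 + 2 * k) xs)
    ≡⟨ ≡.trans (map-concatSelect pairs _ xs)
         (concatSelect-cong (λ y ys → ≡.trans (cong (map pairs) (map-concatSelect (y ∷_) _ ys))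
                                              (map-concatSelect pairs _ ys)) xs) ⟩
  concatSelect₂ (λ y z s → map pairs (map (y ∷_) (map (z ∷_) (arrangements (2 * k) s)))) xs
    ≡⟨ concatSelect-cong (λ y → concatSelect-cong (λ z s →
         let U = arrangements (2 * k) s in
         ≡.trans (sym (List.map-∘ (map (z ∷_) U))) (≡.trans (sym (List.map-∘ U)) (List.map-∘ U)))) xs ⟩
  concatSelect₂ (λ y z s → map ((y , z) ∷_) (map pairs (arrangements (2 * k) s))) xs
    ≡⟨ concatSelect-cong (λ y → concatSelect-cong (λ z s →
         cong (map ((y , z) ∷_)) (pairs-arrangements k s))) xs ⟩
  orderedMatchings (suc k) xs ∎
  where open ≡-Reasoning

insertPair : X → X → List (X × X) → List (List (X × X))
insertPair x j u = insertions (x , j) u ++ insertions (j , x) u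

laterInsertPair : X → X → List (X × X) → List (List (X × X))
laterInsertPair x j u = laterInsertions (x , j) u ++ laterInsertions (j , x) u

concatMap-insertPair : (x j : X) (U : List (List (X × X))) →
  concatMap (insertPair x j) U
    ↭ map ((x , j) ∷_) U ++ map ((j , x) ∷_) U ++ concatMap (laterInsertPair x j) U
concatMap-insertPair x j U = begin
  concatMap (insertPair x j) U
    ↭⟨ concatMap-cong-↭ insertPair-head U ⟩
  concatMap (λ u → ((x , j) ∷ u) ∷ [] ++ ((j , x) ∷ u) ∷ [] ++ laterInsertPair x j u) U
    ↭⟨ concatMap-++-↭ _ _ U ⟩
  concatMap (λ u → ((x , j) ∷ u) ∷ []) U
    ++ concatMap (λ u → ((j , x) ∷ u) ∷ [] ++ laterInsertPair x j u) U
    ↭⟨ ++⁺ˡ (concatMap (λ u → ((x , j) ∷ u) ∷ []) U) (concatMap-++-↭ _ _ U) ⟩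
  concatMap (λ u → ((x , j) ∷ u) ∷ []) U ++ concatMap (λ u → ((j , x) ∷ u) ∷ []) U
    ++ concatMap (laterInsertPair x j) U
    ≡⟨ cong₂ (λ V W → V ++ W ++ concatMap (laterInsertPair x j) U)
         (concatMap-singleton ((x , j) ∷_) U) (concatMap-singleton ((j , x) ∷_) U) ⟩
  map ((x , j) ∷_) U ++ map ((j , x) ∷_) U ++ concatMap (laterInsertPair x j) U ∎
  where
  open PermutationReasoning
  insertPair-head : ∀ u → insertPair x j u ↭ ((x , j) ∷ u) ∷ ((j , x) ∷ u) ∷ laterInsertPair x j u
  insertPair-head u rewrite insertions-head (x , j) u | insertions-head (j , x) u =
    ↭-prep _ (shift _ (laterInsertions (x , j) u) (laterInsertions (j , x) u))

concatMap-laterInsertPair-∷ : (x j : X) (p : X × X) (U : List (List (X × X))) →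
  concatMap (laterInsertPair x j) (map (p ∷_) U) ≡ map (p ∷_) (concatMap (insertPair x j) U)
concatMap-laterInsertPair-∷ x j p U = begin
  concatMap (laterInsertPair x j) (map (p ∷_) U)
    ≡⟨ List.concatMap-map (laterInsertPair x j) (p ∷_) U ⟩
  concatMap (λ u → map (p ∷_) (insertions (x , j) u) ++ map (p ∷_) (insertions (j , x) u)) U
    ≡⟨ List.concatMap-cong (λ u → sym (List.map-++ (p ∷_) (insertions (x , j) u) _)) U ⟩
  concatMap (map (p ∷_) ∘ insertPair x j) U
    ≡⟨ List.map-concatMap (p ∷_) (insertPair x j) U ⟨
  map (p ∷_) (concatMap (insertPair x j) U) ∎
  where open ≡-Reasoning

-- The pair containing x is either first, in one of two orientations, or it is inserted
-- behind the first pair of an ordered matching of the other entries.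
orderedMatchings-∷ : ∀ k (x : X) xs →
  orderedMatchings (suc k) (x ∷ xs)
    ↭ concatSelect (λ j r → concatMap (insertPair x j) (orderedMatchings k r)) xs

laterInsertPair-orderedMatchings : ∀ k (x : X) xs →
  concatSelect₂ (λ a b s → map ((a , b) ∷_) (orderedMatchings k (x ∷ s))) xs
    ↭ concatSelect (λ j r → concatMap (laterInsertPair x j) (orderedMatchings k r)) xs

orderedMatchings-∷ k x xs = begin
  orderedMatchings (suc k) (x ∷ xs)
    ↭⟨ concatSelect₂-∷ _ x xs ⟩
  concatSelect first xs ++ concatSelect second xs
    ++ concatSelect₂ (λ a b s → map ((a , b) ∷_) (orderedMatchings k (x ∷ s))) xs
    ↭⟨ ++⁺ˡ (concatSelect first xs) (++⁺ˡ (concatSelect second xs)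
         (laterInsertPair-orderedMatchings k x xs)) ⟩
  concatSelect first xs ++ concatSelect second xs ++ concatSelect later xs
    ↭⟨ ++⁺ˡ (concatSelect first xs) (concatSelect-++-↭ second later xs) ⟨
  concatSelect first xs ++ concatSelect (λ j r → second j r ++ later j r) xs
    ↭⟨ concatSelect-++-↭ first _ xs ⟨
  concatSelect (λ j r → first j r ++ second j r ++ later j r) xs
    ↭⟨ concatSelect-cong-↭ (λ j r → concatMap-insertPair x j (orderedMatchings k r)) xs ⟨
  concatSelect (λ j r → concatMap (insertPair x j) (orderedMatchings k r)) xs ∎
  where
  open PermutationReasoning
  first second later : _ → List _ → List (List (_ × _))
  first j r = map ((x , j) ∷_) (orderedMatchings k r)
  second j r = map ((j , x) ∷_) (orderedMatchings k r)
  later j r = concatMap (laterInsertPair x j) (orderedMatchings k r)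

laterInsertPair-orderedMatchings zero x xs = ↭-reflexive (begin
  concatSelect₂ (λ _ _ _ → []) xs
    ≡⟨ concatSelect-cong (λ _ s → MonadProperties.right-zero (select s)) xs ⟩
  concatSelect (λ _ _ → []) xs
    ≡⟨ concatSelect-cong (λ _ → none) xs ⟨
  concatSelect (λ j r → concatMap (laterInsertPair x j) (orderedMatchings zero r)) xs ∎)
  where
  open ≡-Reasoning
  none : ∀ {j} r → concatMap (laterInsertPair x j) (orderedMatchings zero r) ≡ []
  none [] = refl
  none (_ ∷ _) = refl
laterInsertPair-orderedMatchings (suc k) x xs = begin
  concatSelect₂ (λ a b s → map ((a , b) ∷_) (orderedMatchings (suc k) (x ∷ s))) xs
    ↭⟨ concatSelect₂-cong-↭ (λ a b s → ↭-trans (map⁺ ((a , b) ∷_) (orderedMatchings-∷ k x s))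
         (↭-reflexive (map-concatSelect ((a , b) ∷_) _ s))) xs ⟩
  concatSelect₂ (λ a b → concatSelect (λ j → G j a b)) xs
    ↭⟨ concatSelect-concatSelect₂-comm G xs ⟨
  concatSelect (λ j → concatSelect₂ (G j)) xs
    ≡⟨ concatSelect-cong (λ j r → ≡.trans (concatMap-concatSelect₂ (laterInsertPair x j) _ r)
         (concatSelect-cong (λ a → concatSelect-cong (λ b s →
            concatMap-laterInsertPair-∷ x j (a , b) (orderedMatchings k s))) r)) xs ⟨
  concatSelect (λ j r → concatMap (laterInsertPair x j) (orderedMatchings (suc k) r)) xs ∎
  where
  open PermutationReasoning
  G : _ → _ → _ → List _ → List (List (_ × _))
  G j a b s = map ((a , b) ∷_) (concatMap (insertPair x j) (orderedMatchings k s))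

orientedOrderings : List (X × X) → List (List (X × X))
orientedOrderings = foldr (λ p → concatMap (insertPair (proj₁ p) (proj₂ p))) ([] ∷ [])

matchings-orderedMatchings : ∀ k (xs : List X) →
  concatMap orientedOrderings (matchings k xs) ↭ orderedMatchings k xs
matchings-orderedMatchings zero [] = ↭-refl
matchings-orderedMatchings zero (_ ∷ _) = ↭-refl
matchings-orderedMatchings (suc k) [] = ↭-refl
matchings-orderedMatchings (suc k) (x ∷ xs) = begin
  concatMap orientedOrderings (matchings (suc k) (x ∷ xs))
    ≡⟨ concatMap-concatSelect orientedOrderings _ xs ⟩
  concatSelect (λ j r → concatMap orientedOrderings (map ((x , j) ∷_) (matchings k r))) xs
    ≡⟨ concatSelect-cong (λ j r → ≡.trans (List.concatMap-map orientedOrderings _ (matchings k r))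
         (sym (concatMap-concatMap (insertPair x j) orientedOrderings (matchings k r)))) xs ⟩
  concatSelect (λ j r → concatMap (insertPair x j) (concatMap orientedOrderings (matchings k r))) xs
    ↭⟨ concatSelect-cong-↭ (λ j r → concatMap⁺ (insertPair x j) (matchings-orderedMatchings k r)) xs ⟩
  concatSelect (λ j r → concatMap (insertPair x j) (orderedMatchings k r)) xs
    ↭⟨ orderedMatchings-∷ k x xs ⟨
  orderedMatchings (suc k) (x ∷ xs) ∎
  where open PermutationReasoning

matchings-AllPairs : ∀ {R : X → X → Set a} k {xs} → AllPairs R xs →
                     All (All (λ p → R (proj₁ p) (proj₂ p))) (matchings k xs)
matchings-AllPairs zero [] = [] ∷ []
matchings-AllPairs zero (_ ∷ _) = []
matchings-AllPairs (suc k) [] = []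
matchings-AllPairs (suc k) (rx ∷ rxs) = All.concat⁺ (All.map⁺ (All.zipWith
  (λ ((rxj , _) , rr) → All.map⁺ (All.map (rxj ∷_) (matchings-AllPairs k rr)))
  (select-All rx , select-AllPairs rxs)))

module WordMultisets {c ℓ} (R : CommutativeRing c ℓ) (m : ℕ) where
  open CommutativeRing R
    using (Carrier; _≈_; 0#; 1#; +-cong; +-congˡ; +-identityˡ; *-cong; *-identityˡ; +-commutativeSemigroup)
    renaming (_+_ to _+ᴿ_; _*_ to _*ᴿ_; refl to ≈-refl; sym to ≈-sym; trans to ≈-trans)
  open import Algebra.Properties.CommutativeSemigroup +-commutativeSemigroup using (x∙yz≈y∙xz)
  open FreeAlg R m

  wordsOf : Poly → List Word
  wordsOf = map proj₂

  HasUnitCoeffs : Poly → Set (c Level.⊔ ℓ)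
  HasUnitCoeffs = All ((_≈ 1#) ∘ proj₁)

  multiplicity : Word → List Word → Carrier
  multiplicity w = foldr (λ u n → (if does (u ≟W w) then 1# else 0#) +ᴿ n) 0#

  multiplicity-↭ : ∀ w {us vs} → us ↭ vs → multiplicity w us ≈ multiplicity w vs
  multiplicity-↭ w refl = ≈-refl
  multiplicity-↭ w (prep u p) = +-congˡ (multiplicity-↭ w p)
  multiplicity-↭ w (swap u v p) = ≈-trans (x∙yz≈y∙xz _ _ _) (+-congˡ (+-congˡ (multiplicity-↭ w p)))
  multiplicity-↭ w (trans p q) = ≈-trans (multiplicity-↭ w p) (multiplicity-↭ w q)

  coeff≈multiplicity : ∀ {p} → HasUnitCoeffs p → ∀ w → coeff p w ≈ multiplicity w (wordsOf p)
  coeff≈multiplicity [] w = ≈-refl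
  coeff≈multiplicity {(_ , u) ∷ p} (r≈1 ∷ p-units) w with u ≟W w
  ... | yes _ = +-cong r≈1 (coeff≈multiplicity p-units w)
  ... | no _ = ≈-trans (coeff≈multiplicity p-units w) (≈-sym (+-identityˡ _))

  ↭⇒≈P : ∀ {p q} → HasUnitCoeffs p → HasUnitCoeffs q → wordsOf p ↭ wordsOf q → p ≈P q
  ↭⇒≈P p-units q-units p↭q w = ≈-trans (coeff≈multiplicity p-units w)
    (≈-trans (multiplicity-↭ w p↭q) (≈-sym (coeff≈multiplicity q-units w)))

  wordsOf-sumP : ∀ ps → wordsOf (sumP ps) ≡ concatMap wordsOf ps
  wordsOf-sumP ps = sym (List.concat-map ps)

  HasUnitCoeffs-sumP : ∀ {ps} → All HasUnitCoeffs ps → HasUnitCoeffs (sumP ps)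
  HasUnitCoeffs-sumP = All.concat⁺

  shuffles : List Word → List Word → List Word
  shuffles us vs = concatMap (λ u → concatMap (shuffleW u) vs) us

  wordsOf-ш : ∀ p q → wordsOf (p ш q) ≡ shuffles (wordsOf p) (wordsOf q)
  wordsOf-ш [] q = refl
  wordsOf-ш ((r , u) ∷ p) q =
    ≡.trans (List.map-++ proj₂ _ (p ш q)) (cong₂ _++_ wordsOf-shuffled (wordsOf-ш p q))
    where
    wordsOf-shuffled : wordsOf (concatMap (λ sv → map (r *ᴿ proj₁ sv ,_) (shuffleW u (proj₂ sv))) q)
                       ≡ concatMap (shuffleW u) (wordsOf q)
    wordsOf-shuffled = begin
      map proj₂ (concatMap (λ sv → map (r *ᴿ proj₁ sv ,_) (shuffleW u (proj₂ sv))) q)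
        ≡⟨ List.map-concatMap proj₂ _ q ⟩
      concatMap (λ sv → map proj₂ (map (r *ᴿ proj₁ sv ,_) (shuffleW u (proj₂ sv)))) q
        ≡⟨ List.concatMap-cong (λ sv →
             ≡.trans (sym (List.map-∘ (shuffleW u (proj₂ sv)))) (List.map-id (shuffleW u (proj₂ sv)))) q ⟩
      concatMap (shuffleW u ∘ proj₂) q
        ≡⟨ List.concatMap-map (shuffleW u) proj₂ q ⟨
      concatMap (shuffleW u) (wordsOf q) ∎
      where open ≡-Reasoning

  HasUnitCoeffs-ш : ∀ {p q} → HasUnitCoeffs p → HasUnitCoeffs q → HasUnitCoeffs (p ш q)
  HasUnitCoeffs-ш [] q-units = []
  HasUnitCoeffs-ш {(r , u) ∷ p} (r≈1 ∷ p-units) q-units =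
    All.++⁺ (All.concat⁺ (All.map⁺ (All.map shuffled-units q-units)))
            (HasUnitCoeffs-ш p-units q-units)
    where
    shuffled-units : ∀ {sv} → proj₁ sv ≈ 1# →
                     HasUnitCoeffs (map (r *ᴿ proj₁ sv ,_) (shuffleW u (proj₂ sv)))
    shuffled-units {sv} s≈1 = All.map⁺ (All.universal
      (λ _ → ≈-trans (*-cong r≈1 s≈1) (*-identityˡ 1#)) (shuffleW u (proj₂ sv)))

  shuffles-↭ʳ : ∀ us {vs vs′} → vs ↭ vs′ → shuffles us vs ↭ shuffles us vs′
  shuffles-↭ʳ us vs↭vs′ = concatMap-cong-↭ (λ u → concatMap⁺ (shuffleW u) vs↭vs′) us

  shuffleW-letter : ∀ (a : Letter) v → shuffleW (a ∷ []) v ≡ insertions a v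
  shuffleW-letter a [] = refl
  shuffleW-letter a (b ∷ v) = cong (((a ∷ b ∷ v) ∷_) ∘ map (b ∷_)) (shuffleW-letter a v)

  shuffles-Q : ∀ {i j} → i ≢ j → ∀ vs → shuffles (wordsOf (Q i j)) vs ↭ concatMap (insertPair i j) vs
  shuffles-Q {i} {j} i≢j vs with i ≟ j
  ... | yes i≡j = ⊥-elim (i≢j i≡j)
  ... | no _ = begin
    concatMap (shuffleW ((i , j) ∷ [])) vs ++ concatMap (shuffleW ((j , i) ∷ [])) vs ++ []
      ≡⟨ cong (concatMap (shuffleW ((i , j) ∷ [])) vs ++_) (List.++-identityʳ _) ⟩
    concatMap (shuffleW ((i , j) ∷ [])) vs ++ concatMap (shuffleW ((j , i) ∷ [])) vs
      ≡⟨ cong₂ _++_ (List.concatMap-cong (shuffleW-letter (i , j)) vs)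
                    (List.concatMap-cong (shuffleW-letter (j , i)) vs) ⟩
    concatMap (insertions (i , j)) vs ++ concatMap (insertions (j , i)) vs
      ↭⟨ concatMap-++-↭ (insertions (i , j)) (insertions (j , i)) vs ⟨
    concatMap (insertPair i j) vs ∎
    where open PermutationReasoning

  HasUnitCoeffs-Q : ∀ i j → HasUnitCoeffs (Q i j)
  HasUnitCoeffs-Q i j with i ≟ j
  ... | yes _ = []
  ... | no _ = ≈-refl ∷ ≈-refl ∷ []

  HasUnitCoeffs-productш : ∀ {ps} → All HasUnitCoeffs ps → HasUnitCoeffs (productш ps)
  HasUnitCoeffs-productш [] = ≈-refl ∷ []
  HasUnitCoeffs-productш (p-units ∷ ps-units) =
    HasUnitCoeffs-ш p-units (HasUnitCoeffs-productш ps-units)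

  productQ : List Letter → Poly
  productQ μ = productш (map (λ p → Q (proj₁ p) (proj₂ p)) μ)

  HasUnitCoeffs-productQ : ∀ μ → HasUnitCoeffs (productQ μ)
  HasUnitCoeffs-productQ μ =
    HasUnitCoeffs-productш (All.map⁺ (All.universal (λ p → HasUnitCoeffs-Q (proj₁ p) (proj₂ p)) μ))

  wordsOf-productQ : ∀ {μ} → All (λ p → proj₁ p ≢ proj₂ p) μ →
                     wordsOf (productQ μ) ↭ orientedOrderings μ
  wordsOf-productQ [] = ↭-refl
  wordsOf-productQ {(i , j) ∷ μ} (i≢j ∷ distinct) = begin
    wordsOf (Q i j ш productQ μ)
      ≡⟨ wordsOf-ш (Q i j) (productQ μ) ⟩
    shuffles (wordsOf (Q i j)) (wordsOf (productQ μ))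
      ↭⟨ shuffles-↭ʳ (wordsOf (Q i j)) (wordsOf-productQ distinct) ⟩
    shuffles (wordsOf (Q i j)) (orientedOrderings μ)
      ↭⟨ shuffles-Q i≢j (orientedOrderings μ) ⟩
    concatMap (insertPair i j) (orientedOrderings μ) ∎
    where open PermutationReasoning

  wordsOf-Hfш-Q : ∀ k → wordsOf (Hfш k Q) ↭ concatMap orientedOrderings (matchings k (allFin m))
  wordsOf-Hfш-Q k = begin
    wordsOf (Hfш k Q)
      ≡⟨ wordsOf-sumP (map productQ (matchings k (allFin m))) ⟩
    concatMap wordsOf (map productQ (matchings k (allFin m)))
      ≡⟨ List.concatMap-map wordsOf productQ (matchings k (allFin m)) ⟩
    concatMap (wordsOf ∘ productQ) (matchings k (allFin m))
      ↭⟨ concatMap-All-cong-↭ (All.map wordsOf-productQ (matchings-AllPairs k (allFin⁺ m))) ⟩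
    concatMap orientedOrderings (matchings k (allFin m)) ∎
    where open PermutationReasoning

  HasUnitCoeffs-Hfш-Q : ∀ k → HasUnitCoeffs (Hfш k Q)
  HasUnitCoeffs-Hfш-Q k =
    HasUnitCoeffs-sumP (All.map⁺ (All.universal HasUnitCoeffs-productQ (matchings k (allFin m))))

  pairWord≡pairs : ∀ σ → pairWord σ ≡ pairs σ
  pairWord≡pairs (x ∷ y ∷ σ) = cong ((x , y) ∷_) (pairWord≡pairs σ)
  pairWord≡pairs (_ ∷ []) = refl
  pairWord≡pairs [] = refl

  wordsOf-permSum : wordsOf permSum ≡ map pairs (perms (allFin m))
  wordsOf-permSum = begin
    wordsOf permSum
      ≡⟨ wordsOf-sumP (map (word ∘ pairWord) (perms (allFin m))) ⟩
    concatMap wordsOf (map (word ∘ pairWord) (perms (allFin m)))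
      ≡⟨ List.concatMap-map wordsOf _ (perms (allFin m)) ⟩
    concatMap (λ σ → pairWord σ ∷ []) (perms (allFin m))
      ≡⟨ concatMap-singleton pairWord (perms (allFin m)) ⟩
    map pairWord (perms (allFin m))
      ≡⟨ List.map-cong pairWord≡pairs (perms (allFin m)) ⟩
    map pairs (perms (allFin m)) ∎
    where open ≡-Reasoning

  HasUnitCoeffs-permSum : HasUnitCoeffs permSum
  HasUnitCoeffs-permSum = HasUnitCoeffs-sumP {map (word ∘ pairWord) (perms (allFin m))}
    (All.map⁺ (All.universal (λ _ → ≈-refl ∷ []) (perms (allFin m))))

mainTheorem3 : ∀ {c ℓ : Level} (R : CommutativeRing c ℓ) (n : ℕ) → 1 ≤ n →
    let open FreeAlg R (2 * n) in permSum ≈P Hfш n Q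
mainTheorem3 R n _ = ↭⇒≈P HasUnitCoeffs-permSum (HasUnitCoeffs-Hfш-Q n) (begin
  wordsOf permSum                              ≡⟨ wordsOf-permSum ⟩
  map pairs (perms xs)                         ↭⟨ map⁺ pairs (perms-↭-arrangements xs) ⟩
  map pairs (arrangements (length xs) xs)      ≡⟨ cong (λ k → map pairs (arrangements k xs)) length-xs ⟩
  map pairs (arrangements (2 * n) xs)          ≡⟨ pairs-arrangements n xs ⟩
  orderedMatchings n xs                        ↭⟨ matchings-orderedMatchings n xs ⟨
  concatMap orientedOrderings (matchings n xs) ↭⟨ wordsOf-Hfш-Q n ⟨
  wordsOf (Hfш n Q)                            ∎)
  where
  open FreeAlg R (2 * n)
  open WordMultisets R (2 * n)
  open PermutationReasoning
  xs : List (Fin (2 * n))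
  xs = allFin (2 * n)
  length-xs : length xs ≡ 2 * n
  length-xs = List.length-tabulate id
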